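{- There are natural isomorphisms of combinatorial species $\mathrm{Ens}(D)\simeq D^*\simeq S_2\times S$.
   Context: A combinatorial species is a functor from the category of finite sets with bijections to the category of finite sets. For a species $F$ with $F(\emptyset)=\emptyset$, $\mathrm{Ens}(F)$ is the species whose structures on a finite set $E$ are set partitions $\{P_1,\dots,P_n\}$ of $E$ together with an $F$-structure on each block $P_i$. The cartesian product $F\times G$ is given by $(F\times G)(E)=F(E)\times G(E)$ with transport of structure componentwise. $S$ is the species of permutations ($S(E)$ = permutations of $E$, transported by conjugation) and $S_2$ the species of involutions ($\sigma^2=\mathrm{id}$). A diagram with arc set $E$ consists of a set $\Gamma_0$ of vertices, maps $s,t:E\to\Gamma_0$, an involution $a\mapsto a^{ -1}$ of $E$ with $s(a^{ -1})=t(a)$, $t(a^{ -1})=s(a)$, and an action $(a,k)\mapsto a+k$ of $\mathbb{Z}$ on $E$ whose orbits are exactly the stars $s^{ -1}(x)$, with no isolated vertex; diagrams are considered up to isomorphisms that are the identity on arcs (equivalently, a diagram on $E$ is determined by an action of $\mathbb{Z}\ast\mathbb{Z}/2\mathbb{Z}$ on $E$). $D^*$ is the species of diagrams (not necessarily connected), with $D^*(E)$ the set of diagrams whose set of arcs is $E$; $D$ is the subspecies of connected diagrams (any two distinct vertices joined by a chain of arcs $a_0,\dots,a_n$ with $t(a_{k-1})=s(a_k)$). -}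

module Defs where

open import Level using (Level) renaming (suc to lsuc; zero to lzero)
open import Data.Nat using (ℕ)
open import Data.Fin using (Fin)
open import Data.Integer using (ℤ; +_; _+_)
open import Data.Product using (Σ; ∃; _×_; _,_; proj₁; proj₂)
open import Data.Sum using (_⊎_)
open import Relation.Binary.PropositionalEquality using (_≡_; _≢_; trans; cong)
open import Function.Bundles using (_↔_; _⇔_; Inverse)

FinSet : Set₁
FinSet = Σ Set (λ E → Σ ℕ (λ n → E ↔ Fin n))

⌞_⌟ : FinSet → Set
⌞ E ⌟ = proj₁ E

-- Species, given by their structures on a set and by the relation
-- "y is the transport of x along the bijection f" (written  Iso f x y,
-- i.e. F[f](x) ≈ y).  The equality of structures on E is  Iso id.

record Species : Set₂ where
  field
    Str : Set → Set₁
    Iso : {A B : Set} → (A → B) → Str A → Str B → Set₁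
open Species public

record NatIso (F G : Species) : Set₂ where
  field
    to      : (E : FinSet) → Str F ⌞ E ⌟ → Str G ⌞ E ⌟
    from    : (E : FinSet) → Str G ⌞ E ⌟ → Str F ⌞ E ⌟
    to-nat  : (E E′ : FinSet) (α : ⌞ E ⌟ ↔ ⌞ E′ ⌟) {x : Str F ⌞ E ⌟} {y : Str F ⌞ E′ ⌟} →
              Iso F (Inverse.to α) x y → Iso G (Inverse.to α) (to E x) (to E′ y)
    from-nat : (E E′ : FinSet) (α : ⌞ E ⌟ ↔ ⌞ E′ ⌟) {x : Str G ⌞ E ⌟} {y : Str G ⌞ E′ ⌟} →
              Iso G (Inverse.to α) x y → Iso F (Inverse.to α) (from E x) (from E′ y)
    from-to : (E : FinSet) (x : Str F ⌞ E ⌟) → Iso F (λ e → e) (from E (to E x)) x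
    to-from : (E : FinSet) (y : Str G ⌞ E ⌟) → Iso G (λ e → e) (to E (from E y)) y

_×ˢ_ : Species → Species → Species
F ×ˢ G = record
  { Str = λ E → Str F E × Str G E
  ; Iso = λ f x y → Iso F f (proj₁ x) (proj₁ y) × Iso G f (proj₂ x) (proj₂ y) }

-- Ens(F): a set partition of E (given by a surjective labelling of the
-- elements by the blocks 0..k-1; relabelling of blocks is part of the
-- equality) together with an F-structure on each block.

Block : {E : Set} {k : ℕ} → (E → Fin k) → Fin k → Set
Block {E} b i = Σ E (λ e → b e ≡ i)

record EnsStr (F : Species) (E : Set) : Set₁ where
  field
    nblocks : ℕ
    block   : E → Fin nblocks
    block-nonempty : ∀ i → ∃ λ e → block e ≡ i
    struct  : (i : Fin nblocks) → Str F (Block block i)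
open EnsStr public

blockMap : {A B : Set} {k k′ : ℕ} (f : A → B) (b : A → Fin k) (b′ : B → Fin k′)
           (ρ : Fin k ↔ Fin k′) → (∀ a → b′ (f a) ≡ Inverse.to ρ (b a)) →
           (i : Fin k) → Block b i → Block b′ (Inverse.to ρ i)
blockMap f b b′ ρ rl i (a , p) = f a , trans (rl a) (cong (Inverse.to ρ) p)

record EnsIso (F : Species) {A B : Set} (f : A → B) (X : EnsStr F A) (Y : EnsStr F B) : Set₁ where
  field
    relabel   : Fin (nblocks X) ↔ Fin (nblocks Y)
    block-comm : ∀ a → block Y (f a) ≡ Inverse.to relabel (block X a)
    struct-iso : ∀ i → Iso F (blockMap f (block X) (block Y) relabel block-comm i)
                              (struct X i) (struct Y (Inverse.to relabel i))

Ens : Species → Species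
Ens F = record { Str = EnsStr F ; Iso = EnsIso F }

record Perm (E : Set) : Set₁ where
  field
    perm : E ↔ E

S : Species
S = record
  { Str = Perm
  ; Iso = λ f x y → Level.Lift _ (∀ a → f (Inverse.to (Perm.perm x) a) ≡ Inverse.to (Perm.perm y) (f a)) }

record Invol (E : Set) : Set₁ where
  field
    inv    : E ↔ E
    invol  : ∀ a → Inverse.to inv (Inverse.to inv a) ≡ a

S₂ : Species
S₂ = record
  { Str = Invol
  ; Iso = λ f x y → Level.Lift _ (∀ a → f (Inverse.to (Invol.inv x) a) ≡ Inverse.to (Invol.inv y) (f a)) }

record Diagram (A : Set) : Set₁ where
  field
    V       : Set
    s t     : A → V
    _⁻¹     : A → A
    ⁻¹-invol : ∀ a → (a ⁻¹) ⁻¹ ≡ a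
    s-⁻¹    : ∀ a → s (a ⁻¹) ≡ t a
    t-⁻¹    : ∀ a → t (a ⁻¹) ≡ s a
    _⊕_     : A → ℤ → A
    ⊕-zero  : ∀ a → a ⊕ (+ 0) ≡ a
    ⊕-assoc : ∀ a k l → (a ⊕ k) ⊕ l ≡ a ⊕ (k + l)
    orbit-star : ∀ a b → (s a ≡ s b) ⇔ (∃ λ k → a ⊕ k ≡ b)
    star-orbit : ∀ x → ∃ λ a → s a ≡ x
    no-isolated : ∀ x → ∃ λ a → (s a ≡ x) ⊎ (t a ≡ x)
open Diagram public

record DiagIso {A B : Set} (f : A → B) (D : Diagram A) (D′ : Diagram B) : Set₁ where
  field
    vmap   : V D ↔ V D′
    s-comm : ∀ a → Inverse.to vmap (s D a) ≡ s D′ (f a)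
    t-comm : ∀ a → Inverse.to vmap (t D a) ≡ t D′ (f a)
    ⁻¹-comm : ∀ a → f (_⁻¹ D a) ≡ _⁻¹ D′ (f a)
    ⊕-comm : ∀ a k → f (_⊕_ D a k) ≡ _⊕_ D′ (f a) k

data Chain {A : Set} (D : Diagram A) : V D → V D → Set where
  single : ∀ {x y} (a : A) → s D a ≡ x → t D a ≡ y → Chain D x y
  _∷_    : ∀ {x y} (a : A) → s D a ≡ x → Chain D (t D a) y → Chain D x y

Connected : {A : Set} → Diagram A → Set
Connected D = ∀ x y → x ≢ y → Chain D x y

D* : Species
D* = record { Str = Diagram ; Iso = DiagIso }

D : Species
D = record
  { Str = λ A → Σ (Diagram A) Connected
  ; Iso = λ f x y → DiagIso f (proj₁ x) (proj₁ y) }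

{-# OPTIONS --safe #-}

-- A diagram on E is the same thing as the pair (ι, σ) of its involution a ↦ a⁻¹ and its
-- rotation a ↦ a + 1: the vertices are recovered as the cycles of σ, with s a the cycle
-- of a and t a the cycle of ι a.  A diagram is the disjoint union of its connected
-- components, the classes of the equivalence relation generated by ι and σ, and gluing
-- a partition of E into connected diagrams gives back a diagram whose components are
-- the blocks.
--
-- Without quotient types, both constructions need the classes of an equivalence relation
-- on a finite set, numbered by some Fin k.  The relations at hand are equivalence closures
-- of decidable relations; they are decidable because saturating a subset of Fin n under
-- a relation becomes stationary after at most n steps, and a decidable equivalence on
-- Fin n is quotiented by induction on n.

module Submission where

open import Defs
open import Level using (0ℓ; lift)
open import Axiom.UniquenessOfIdentityProofs using (UIP; module Decidable⇒UIP)
open import Data.Bool.Properties using () renaming (_≟_ to _≟ᵇ_)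
open import Data.Fin using (Fin; zero; suc)
import Data.Fin.Properties as Fin
open import Data.Fin.Subset using (Subset; _∈_; _⊆_; _⊂_; ⁅_⁆; ∣_∣)
open import Data.Fin.Subset.Properties using (_∈?_; ⊆-antisym; p⊂q⇒∣p∣<∣q∣; ∣p∣≤n; x∈⁅x⁆; x∈⁅y⁆⇒x≡y)
open import Data.Integer using (ℤ; +_; -[1+_]; 0ℤ; 1ℤ; -1ℤ; _+_; -_; pred) renaming (suc to sucℤ)
import Data.Integer.Properties as ℤ
open import Data.Nat using (ℕ; zero; suc; _≤_; z≤n; s≤s)
import Data.Nat.Properties as ℕ
open import Data.Nat.GeneralisedArithmetic using (fold)
open import Data.Product using (Σ; ∃; _×_; _,_; proj₁; proj₂)
open import Data.Product.Properties using (,-injectiveˡ; ,-injectiveʳ-UIP)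
open import Data.Product.Function.Dependent.Propositional using (Σ-↔)
open import Data.Sum using (_⊎_; inj₁; inj₂; [_,_])
open import Data.Vec using (tabulate)
import Data.Vec.Properties as Vec
open import Function using (_∘_; id; _on_)
open import Function.Bundles using (_↔_; Inverse; Injection; mk↔ₛ′; Equivalence; _⇔_; mk⇔)
open import Function.Construct.Composition using (_↔-∘_)
open import Function.Properties.Inverse using (↔⇒↣; ↔-refl)
open import Relation.Nullary using (yes; no; does; ¬_; ¬?; contradiction)
open import Relation.Nullary.Decidable using (map′; _×-dec_; _⊎-dec_; dec-true; decidable-stable)
open import Relation.Unary as U using (Pred)
open import Relation.Binary using (Rel; Decidable; DecidableEquality; IsDecEquivalence; IsEquivalence)
import Relation.Binary.Construct.On as On
open import Relation.Binary.PropositionalEquality hiding ([_])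
open import Relation.Binary.Construct.Closure.ReflexiveTransitive as Star using (ε; _◅_; _◅◅_)
open import Relation.Binary.Construct.Closure.Symmetric using (SymClosure; fwd; bwd)
open import Relation.Binary.Construct.Closure.Equivalence as EqClosure using (EqClosure)

decEq : {A : Set} {n : ℕ} → A ↔ Fin n → DecidableEquality A
decEq enum = Fin.inj⇒≟ (↔⇒↣ enum)

↔-injective : {A B : Set} (α : A ↔ B) → ∀ {a b} → Inverse.to α a ≡ Inverse.to α b → a ≡ b
↔-injective α = Injection.injective (↔⇒↣ α)

Fin-UIP : ∀ {k} → UIP (Fin k)
Fin-UIP = Decidable⇒UIP.≡-irrelevant Fin._≟_

fibre-≡ : {X : Set} {k : ℕ} {f : X → Fin k} {i : Fin k} {u v : Σ X (λ x → f x ≡ i)} →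
          proj₁ u ≡ proj₁ v → u ≡ v
fibre-≡ {u = x , p} {.x , q} refl = cong (x ,_) (Fin-UIP p q)

Fin-≡-↔ : ∀ {k l} {i j : Fin k} {i′ j′ : Fin l} → (i ≡ j) ⇔ (i′ ≡ j′) → (i ≡ j) ↔ (i′ ≡ j′)
Fin-≡-↔ e = mk↔ₛ′ (Equivalence.to e) (Equivalence.from e) (λ _ → Fin-UIP _ _) (λ _ → Fin-UIP _ _)

Σ-fibres↔ : {X I : Set} (f : X → I) → Σ I (λ i → Σ X (λ x → f x ≡ i)) ↔ X
Σ-fibres↔ f = mk↔ₛ′ (proj₁ ∘ proj₂) (λ x → f x , x , refl) (λ _ → refl) (λ { (_ , _ , refl) → refl })

Σ-singleton↔ : {I : Set} {P : I → Set} {i₀ : I} → Σ (Σ I P) (λ x → proj₁ x ≡ i₀) ↔ P i₀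
Σ-singleton↔ {P = P} = mk↔ₛ′ (λ { ((_ , v) , e) → subst P e v }) (λ v → (_ , v) , refl)
  (λ _ → refl) (λ { ((_ , _) , refl) → refl })

-- Finite quotients

-- A/∼ is presented by a numbering of its classes and a representative of each class.
record Quotient {A : Set} (_∼_ : Rel A 0ℓ) : Set where
  field
    size    : ℕ
    cls     : A → Fin size
    wit     : Fin size → A
    cls-wit : ∀ i → cls (wit i) ≡ i
    cls-≡⇒∼ : ∀ {a b} → cls a ≡ cls b → a ∼ b
    ∼⇒cls-≡ : ∀ {a b} → a ∼ b → cls a ≡ cls b

module _ {n : ℕ} {_∼_ : Rel (Fin (suc n)) 0ℓ} (∼-isDecEquivalence : IsDecEquivalence _∼_)
         (Q : Quotient (_∼_ on suc)) where
  open IsDecEquivalence ∼-isDecEquivalence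
    using () renaming (refl to ∼-refl; sym to ∼-sym; trans to ∼-trans; _≟_ to _∼?_)
  open Quotient Q

  private
    quotientJoiningZero : ∀ j → zero ∼ suc j → Quotient _∼_
    quotientJoiningZero j zero∼j = record
      { size = size ; cls = cls₀ ; wit = suc ∘ wit ; cls-wit = cls-wit ; cls-≡⇒∼ = cls₀-≡⇒∼ ; ∼⇒cls-≡ = ∼⇒cls₀-≡ }
      where
      cls₀ : Fin (suc n) → Fin size
      cls₀ zero    = cls j
      cls₀ (suc a) = cls a

      cls₀-≡⇒∼ : ∀ {a b} → cls₀ a ≡ cls₀ b → a ∼ b
      cls₀-≡⇒∼ {zero}  {zero}  _ = ∼-refl
      cls₀-≡⇒∼ {zero}  {suc b} e = ∼-trans zero∼j (cls-≡⇒∼ e)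
      cls₀-≡⇒∼ {suc a} {zero}  e = ∼-trans (cls-≡⇒∼ e) (∼-sym zero∼j)
      cls₀-≡⇒∼ {suc a} {suc b} e = cls-≡⇒∼ e

      ∼⇒cls₀-≡ : ∀ {a b} → a ∼ b → cls₀ a ≡ cls₀ b
      ∼⇒cls₀-≡ {zero}  {zero}  _ = refl
      ∼⇒cls₀-≡ {zero}  {suc b} r = ∼⇒cls-≡ (∼-trans (∼-sym zero∼j) r)
      ∼⇒cls₀-≡ {suc a} {zero}  r = ∼⇒cls-≡ (∼-trans r zero∼j)
      ∼⇒cls₀-≡ {suc a} {suc b} r = ∼⇒cls-≡ r

    quotientIsolatingZero : (∀ j → ¬ zero ∼ suc j) → Quotient _∼_
    quotientIsolatingZero zero≁ = record
      { size = suc size ; cls = cls₀ ; wit = wit₀ ; cls-wit = cls₀-wit₀ ; cls-≡⇒∼ = cls₀-≡⇒∼ ; ∼⇒cls-≡ = ∼⇒cls₀-≡ }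
      where
      cls₀ : Fin (suc n) → Fin (suc size)
      cls₀ zero    = zero
      cls₀ (suc a) = suc (cls a)

      wit₀ : Fin (suc size) → Fin (suc n)
      wit₀ zero    = zero
      wit₀ (suc i) = suc (wit i)

      cls₀-wit₀ : ∀ i → cls₀ (wit₀ i) ≡ i
      cls₀-wit₀ zero    = refl
      cls₀-wit₀ (suc i) = cong suc (cls-wit i)

      cls₀-≡⇒∼ : ∀ {a b} → cls₀ a ≡ cls₀ b → a ∼ b
      cls₀-≡⇒∼ {zero}  {zero}  _ = ∼-refl
      cls₀-≡⇒∼ {suc a} {suc b} e = cls-≡⇒∼ (Fin.suc-injective e)

      ∼⇒cls₀-≡ : ∀ {a b} → a ∼ b → cls₀ a ≡ cls₀ b
      ∼⇒cls₀-≡ {zero}  {zero}  _ = refl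
      ∼⇒cls₀-≡ {zero}  {suc b} r = contradiction r (zero≁ b)
      ∼⇒cls₀-≡ {suc a} {zero}  r = contradiction (∼-sym r) (zero≁ a)
      ∼⇒cls₀-≡ {suc a} {suc b} r = cong suc (∼⇒cls-≡ r)

  quotientSuc : Quotient _∼_
  quotientSuc with Fin.any? (λ j → zero ∼? suc j)
  ... | yes (j , zero∼j) = quotientJoiningZero j zero∼j
  ... | no ∄j            = quotientIsolatingZero (λ j zero∼j → ∄j (j , zero∼j))

quotientFin : ∀ n {_∼_ : Rel (Fin n) 0ℓ} → IsDecEquivalence _∼_ → Quotient _∼_
quotientFin zero    _ = record
  { size = 0 ; cls = λ () ; wit = λ () ; cls-wit = λ () ; cls-≡⇒∼ = λ { {()} } ; ∼⇒cls-≡ = λ { {()} } }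
quotientFin (suc n) isDecEq = quotientSuc isDecEq (quotientFin n (On.isDecEquivalence suc isDecEq))

module _ {A : Set} {n : ℕ} (enum : A ↔ Fin n) where
  open Inverse enum

  quotient : {_∼_ : Rel A 0ℓ} → IsDecEquivalence _∼_ → Quotient _∼_
  quotient {_∼_} isDecEq = record
    { size    = size
    ; cls     = cls ∘ to
    ; wit     = from ∘ wit
    ; cls-wit = λ i → trans (cong cls (strictlyInverseˡ (wit i))) (cls-wit i)
    ; cls-≡⇒∼ = λ e → subst₂ _∼_ (strictlyInverseʳ _) (strictlyInverseʳ _) (cls-≡⇒∼ e)
    ; ∼⇒cls-≡ = λ r → ∼⇒cls-≡ (subst₂ _∼_ (sym (strictlyInverseʳ _)) (sym (strictlyInverseʳ _)) r)
    }
    where open Quotient (quotientFin n (On.isDecEquivalence from isDecEq))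

module _ {A : Set} {_∼_ : Rel A 0ℓ} (Q : Quotient _∼_) where
  open Quotient Q

  classes↔ : {B : Set} (f : A → B) → (∀ b → ∃ λ a → f a ≡ b) →
             (∀ {a a′} → f a ≡ f a′ → a ∼ a′) → (∀ {a a′} → a ∼ a′ → f a ≡ f a′) →
             Σ (Fin size ↔ B) (λ ρ → ∀ a → Inverse.to ρ (cls a) ≡ f a)
  classes↔ f f-surjective f-≡⇒∼ ∼⇒f-≡ = mk↔ₛ′ (f ∘ wit) (cls ∘ preimage) to∘from from∘to , to∘cls
    where
    preimage : _ → A
    preimage b = proj₁ (f-surjective b)
    to∘cls : ∀ a → f (wit (cls a)) ≡ f a
    to∘cls a = ∼⇒f-≡ (cls-≡⇒∼ (cls-wit (cls a)))
    to∘from : ∀ b → f (wit (cls (preimage b))) ≡ b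
    to∘from b = trans (to∘cls (preimage b)) (proj₂ (f-surjective b))
    from∘to : ∀ i → cls (preimage (f (wit i))) ≡ i
    from∘to i = trans (∼⇒cls-≡ (f-≡⇒∼ (proj₂ (f-surjective (f (wit i)))))) (cls-wit i)

quotient-transport : {A B : Set} (α : A ↔ B) {_∼_ : Rel A 0ℓ} {_∼′_ : Rel B 0ℓ}
                     (Q : Quotient _∼_) (Q′ : Quotient _∼′_) →
                     (∀ {a b} → a ∼ b ⇔ Inverse.to α a ∼′ Inverse.to α b) →
                     Σ (Fin (Quotient.size Q) ↔ Fin (Quotient.size Q′))
                       (λ ρ → ∀ a → Inverse.to ρ (Quotient.cls Q a) ≡ Quotient.cls Q′ (Inverse.to α a))
quotient-transport α Q Q′ ∼⇔∼′ = classes↔ Q (cls′ ∘ to)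
  (λ i → from (wit′ i) , trans (cong cls′ (strictlyInverseˡ _)) (cls-wit′ i))
  (λ e → Equivalence.from ∼⇔∼′ (cls-≡⇒∼′ e))
  (λ r → ∼⇒cls-≡′ (Equivalence.to ∼⇔∼′ r))
  where
  open Inverse α
  open Quotient Q′ renaming (cls to cls′; wit to wit′; cls-wit to cls-wit′; cls-≡⇒∼ to cls-≡⇒∼′; ∼⇒cls-≡ to ∼⇒cls-≡′)

-- Equivalence closures on finite sets

module _ {n : ℕ} where

  ⟦_⟧ : {P : Pred (Fin n) 0ℓ} → U.Decidable P → Subset n
  ⟦ P? ⟧ = tabulate (does ∘ P?)

  ∈⟦⟧⁺ : {P : Pred (Fin n) 0ℓ} (P? : U.Decidable P) {x : Fin n} → P x → x ∈ ⟦ P? ⟧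
  ∈⟦⟧⁺ P? {x} px = Vec.lookup⇒[]= x _ (trans (Vec.lookup∘tabulate _ x) (dec-true (P? x) px))

  ∈⟦⟧⁻ : {P : Pred (Fin n) 0ℓ} (P? : U.Decidable P) {x : Fin n} → x ∈ ⟦ P? ⟧ → P x
  ∈⟦⟧⁻ P? {x} x∈ with P? x | trans (sym (Vec.lookup∘tabulate _ x)) (Vec.[]=⇒lookup x∈)
  ... | yes px | _ = px

  ⊆∧≢⇒⊂ : {p q : Subset n} → p ⊆ q → p ≢ q → p ⊂ q
  ⊆∧≢⇒⊂ {p} {q} p⊆q p≢q = p⊆q , decidable-stable (Fin.any? λ x → x ∈? q ×-dec ¬? (x ∈? p)) λ ∄x →
    p≢q (⊆-antisym p⊆q λ {x} x∈q → decidable-stable (x ∈? p) λ x∉p → ∄x (x , x∈q , x∉p))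

module _ {n : ℕ} (f : Subset n → Subset n) (f-inflationary : ∀ p → p ⊆ f p) where

  fold-inflationary : ∀ m {p} → p ⊆ fold p f m
  fold-inflationary zero    = id
  fold-inflationary (suc m) = f-inflationary _ ∘ fold-inflationary m

  -- Until it is fixed, each iteration of f adds an element.
  fold-stabilises : ∀ m p → f (fold p f m) ≡ fold p f m ⊎ m ≤ ∣ fold p f m ∣
  fold-stabilises zero    p = inj₂ z≤n
  fold-stabilises (suc m) p with fold-stabilises m p | Vec.≡-dec _≟ᵇ_ (f (fold p f m)) (fold p f m)
  ... | inj₁ fixed | _         = inj₁ (cong f fixed)
  ... | inj₂ _     | yes fixed = inj₁ (cong f fixed)
  ... | inj₂ m≤∣p∣ | no moved  =
    inj₂ (ℕ.≤-trans (s≤s m≤∣p∣) (p⊂q⇒∣p∣<∣q∣ (⊆∧≢⇒⊂ (f-inflationary _) (moved ∘ sym))))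

  fixpoint : Subset n → Subset n
  fixpoint p = fold p f (suc n)

  fixpoint-fixed : ∀ p → f (fixpoint p) ≡ fixpoint p
  fixpoint-fixed p with fold-stabilises (suc n) p
  ... | inj₁ fixed    = fixed
  ... | inj₂ n<∣fix∣ = contradiction (∣p∣≤n (fixpoint p)) (ℕ.<⇒≱ n<∣fix∣)

module _ {n : ℕ} {R : Rel (Fin n) 0ℓ} (R? : Decidable R) where

  private
    symClosure? : Decidable (SymClosure R)
    symClosure? x y = map′ [ fwd , bwd ] (λ { (fwd r) → inj₁ r ; (bwd r) → inj₂ r }) (R? x y ⊎-dec R? y x)

    Neighbourhood : Subset n → Pred (Fin n) 0ℓ
    Neighbourhood p y = y ∈ p ⊎ ∃ λ x → x ∈ p × SymClosure R x y

    neighbourhood? : ∀ p → U.Decidable (Neighbourhood p)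
    neighbourhood? p y = y ∈? p ⊎-dec Fin.any? (λ x → x ∈? p ×-dec symClosure? x y)

    adjoinNeighbours : Subset n → Subset n
    adjoinNeighbours p = ⟦ neighbourhood? p ⟧

    ∈-adjoinNeighbours : ∀ {p y} → y ∈ adjoinNeighbours p ⇔ Neighbourhood p y
    ∈-adjoinNeighbours = mk⇔ (∈⟦⟧⁻ (neighbourhood? _)) (∈⟦⟧⁺ (neighbourhood? _))

    adjoinNeighbours-inflationary : ∀ p → p ⊆ adjoinNeighbours p
    adjoinNeighbours-inflationary p y∈p = Equivalence.from ∈-adjoinNeighbours (inj₁ y∈p)

    orbit : Fin n → Subset n
    orbit a = fixpoint adjoinNeighbours adjoinNeighbours-inflationary ⁅ a ⁆

    orbit-sound : ∀ m {a y} → y ∈ fold ⁅ a ⁆ adjoinNeighbours m → EqClosure R a y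
    orbit-sound zero    {a} y∈ = subst (EqClosure R a) (sym (x∈⁅y⁆⇒x≡y a y∈)) ε
    orbit-sound (suc m) y∈ with Equivalence.to ∈-adjoinNeighbours y∈
    ... | inj₁ y∈p             = orbit-sound m y∈p
    ... | inj₂ (x , x∈p , xRy) = orbit-sound m x∈p ◅◅ (xRy ◅ ε)

    orbit-complete : ∀ {a y} → EqClosure R a y → y ∈ orbit a
    orbit-complete = Star.foldl (λ a y → y ∈ orbit a) step
      (fold-inflationary adjoinNeighbours adjoinNeighbours-inflationary (suc n) (x∈⁅x⁆ _))
      where
      step : ∀ {a x y} → x ∈ orbit a → SymClosure R x y → y ∈ orbit a
      step {a} x∈ xRy = subst (_ ∈_) (fixpoint-fixed adjoinNeighbours adjoinNeighbours-inflationary ⁅ a ⁆)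
        (Equivalence.from ∈-adjoinNeighbours (inj₂ (_ , x∈ , xRy)))

  eqClosureFin? : Decidable (EqClosure R)
  eqClosureFin? a b = map′ (orbit-sound (suc n)) orbit-complete (b ∈? orbit a)

module _ {A B : Set} (α : A ↔ B) {R : Rel A 0ℓ} {R′ : Rel B 0ℓ} where
  open Inverse α

  eqClosure-transport : (∀ {a b} → R a b ⇔ R′ (to a) (to b)) →
                        ∀ {a b} → EqClosure R a b ⇔ EqClosure R′ (to a) (to b)
  eqClosure-transport R⇔R′ {a} {b} = mk⇔ (EqClosure.gmap to (Equivalence.to R⇔R′)) λ r →
    subst₂ (EqClosure R) (strictlyInverseʳ a) (strictlyInverseʳ b) (EqClosure.gmap from R′⇒R r)
    where
    R′⇒R : ∀ {x y} → R′ x y → R (from x) (from y)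
    R′⇒R r = Equivalence.from R⇔R′ (subst₂ R′ (sym (strictlyInverseˡ _)) (sym (strictlyInverseˡ _)) r)

module _ {A : Set} {n : ℕ} (enum : A ↔ Fin n) {R : Rel A 0ℓ} (R? : Decidable R) where
  open Inverse enum

  eqClosure? : Decidable (EqClosure R)
  eqClosure? a b = map′ (Equivalence.from closure⇔) (Equivalence.to closure⇔)
    (eqClosureFin? (λ i j → R? (from i) (from j)) (to a) (to b))
    where
    closure⇔ = eqClosure-transport enum {R = R} {R′ = R on from} (mk⇔
      (subst₂ R (sym (strictlyInverseʳ _)) (sym (strictlyInverseʳ _)))
      (subst₂ R (strictlyInverseʳ _) (strictlyInverseʳ _)))

  opaque
    closureQuotient : Quotient (EqClosure R)
    closureQuotient = quotient enum record
      { isEquivalence = EqClosure.isEquivalence R ; _≟_ = eqClosure? }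

-- ℤ-actions

record ℤAction (A : Set) : Set where
  infixl 6 _·_
  field
    _·_     : A → ℤ → A
    ·-zero  : ∀ a → a · 0ℤ ≡ a
    ·-assoc : ∀ a k l → a · k · l ≡ a · (k + l)

  Shift : Rel A 0ℓ
  Shift a b = a · 1ℤ ≡ b

  SameOrbit : Rel A 0ℓ
  SameOrbit a b = ∃ λ k → a · k ≡ b

  ·-suc : ∀ a m → a · + m · 1ℤ ≡ a · + suc m
  ·-suc a m = trans (·-assoc a (+ m) 1ℤ) (cong (λ j → a · + j) (ℕ.+-comm m 1))

  ·-cancel : ∀ a k → a · k · (- k) ≡ a
  ·-cancel a k = trans (·-assoc a k (- k)) (trans (cong (a ·_) (ℤ.+-inverseʳ k)) (·-zero a))

  shifts-·ℕ : ∀ a m → EqClosure Shift a (a · + m)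
  shifts-·ℕ a zero    = subst (EqClosure Shift a) (sym (·-zero a)) ε
  shifts-·ℕ a (suc m) = shifts-·ℕ a m ◅◅ (fwd (·-suc a m) ◅ ε)

  -- a is m + 1 shifts after a · -[1+ m ].
  shifts-· : ∀ a k → EqClosure Shift a (a · k)
  shifts-· a (+ m)    = shifts-·ℕ a m
  shifts-· a -[1+ m ] = EqClosure.symmetric Shift
    (subst (EqClosure Shift _) (·-cancel a -[1+ m ]) (shifts-·ℕ (a · -[1+ m ]) (suc m)))

  sameOrbit-isEquivalence : IsEquivalence SameOrbit
  sameOrbit-isEquivalence = record
    { refl  = 0ℤ , ·-zero _
    ; sym   = λ { {a} (k , refl) → - k , ·-cancel a k }
    ; trans = λ { {a} (k , refl) (l , refl) → k + l , sym (·-assoc a k l) }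
    }

  sameOrbit⇔shifts : ∀ {a b} → SameOrbit a b ⇔ EqClosure Shift a b
  sameOrbit⇔shifts = mk⇔ (λ { (k , refl) → shifts-· _ k })
    (EqClosure.fold sameOrbit-isEquivalence (1ℤ ,_))

open ℤAction using (Shift)

equivariant : {A B : Set} (X : ℤAction A) (Y : ℤAction B) (f : A → B) →
              (∀ a → f (ℤAction._·_ X a 1ℤ) ≡ ℤAction._·_ Y (f a) 1ℤ) →
              ∀ a k → f (ℤAction._·_ X a k) ≡ ℤAction._·_ Y (f a) k
equivariant X Y f f-shift = f-·
  where
  open ℤAction X using (_·_; ·-suc; ·-cancel)
  open ℤAction Y using () renaming (_·_ to _·′_; ·-suc to ·′-suc; ·-cancel to ·′-cancel)

  f-·ℕ : ∀ a m → f (a · + m) ≡ f a ·′ + m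
  f-·ℕ a zero    = trans (cong f (ℤAction.·-zero X a)) (sym (ℤAction.·-zero Y (f a)))
  f-·ℕ a (suc m) = begin
    f (a · + suc m)      ≡⟨ cong f (·-suc a m) ⟨
    f (a · + m · 1ℤ)     ≡⟨ f-shift (a · + m) ⟩
    f (a · + m) ·′ 1ℤ    ≡⟨ cong (_·′ 1ℤ) (f-·ℕ a m) ⟩
    f a ·′ + m ·′ 1ℤ     ≡⟨ ·′-suc (f a) m ⟩
    f a ·′ + suc m       ∎
    where open ≡-Reasoning

  f-· : ∀ a k → f (a · k) ≡ f a ·′ k
  f-· a (+ m)    = f-·ℕ a m
  f-· a -[1+ m ] = begin
    f (a · -[1+ m ])                          ≡⟨ ·′-cancel (f (a · -[1+ m ])) (+ suc m) ⟨
    f (a · -[1+ m ]) ·′ + suc m ·′ -[1+ m ]   ≡⟨ cong (_·′ -[1+ m ]) (f-·ℕ (a · -[1+ m ]) (suc m)) ⟨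
    f (a · -[1+ m ] · + suc m) ·′ -[1+ m ]    ≡⟨ cong (λ b → f b ·′ -[1+ m ]) (·-cancel a -[1+ m ]) ⟩
    f a ·′ -[1+ m ]                           ∎
    where open ≡-Reasoning

+-sucℤ : ∀ i j → i + sucℤ j ≡ sucℤ (i + j)
+-sucℤ i j = trans (sym (ℤ.+-assoc i 1ℤ j)) (trans (cong (_+ j) (ℤ.+-comm i 1ℤ)) (ℤ.+-assoc 1ℤ i j))

module _ {A : Set} (σ : A ↔ A) where
  open Inverse σ

  iterateℤ : ℤ → A → A
  iterateℤ (+ zero)     = id
  iterateℤ (+ suc m)    = to ∘ iterateℤ (+ m)
  iterateℤ -[1+ zero ]  = from
  iterateℤ -[1+ suc m ] = from ∘ iterateℤ -[1+ m ]

  iterateℤ-suc : ∀ k a → iterateℤ (sucℤ k) a ≡ to (iterateℤ k a)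
  iterateℤ-suc (+ m)        a = refl
  iterateℤ-suc -[1+ zero ]  a = sym (strictlyInverseˡ a)
  iterateℤ-suc -[1+ suc m ] a = sym (strictlyInverseˡ _)

  iterateℤ-pred : ∀ k a → iterateℤ (pred k) a ≡ from (iterateℤ k a)
  iterateℤ-pred -[1+ m ]  a = refl
  iterateℤ-pred (+ zero)  a = refl
  iterateℤ-pred (+ suc m) a = sym (strictlyInverseʳ _)

  iterateℤ-+ : ∀ a k l → iterateℤ l (iterateℤ k a) ≡ iterateℤ (k + l) a
  iterateℤ-+ a k (+ zero)     = cong (λ j → iterateℤ j a) (sym (ℤ.+-identityʳ k))
  iterateℤ-+ a k (+ suc m)    = begin
    to (iterateℤ (+ m) (iterateℤ k a))  ≡⟨ cong to (iterateℤ-+ a k (+ m)) ⟩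
    to (iterateℤ (k + + m) a)           ≡⟨ iterateℤ-suc (k + + m) a ⟨
    iterateℤ (sucℤ (k + + m)) a         ≡⟨ cong (λ j → iterateℤ j a) (+-sucℤ k (+ m)) ⟨
    iterateℤ (k + + suc m) a            ∎
    where open ≡-Reasoning
  iterateℤ-+ a k -[1+ zero ]  = trans (sym (iterateℤ-pred k a)) (cong (λ j → iterateℤ j a) (ℤ.+-comm -1ℤ k))
  iterateℤ-+ a k -[1+ suc m ] = begin
    from (iterateℤ -[1+ m ] (iterateℤ k a))  ≡⟨ cong from (iterateℤ-+ a k -[1+ m ]) ⟩
    from (iterateℤ (k + -[1+ m ]) a)         ≡⟨ iterateℤ-pred (k + -[1+ m ]) a ⟨
    iterateℤ (pred (k + -[1+ m ])) a         ≡⟨ cong (λ j → iterateℤ j a) (ℤ.+-pred k -[1+ m ]) ⟨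
    iterateℤ (k + -[1+ suc m ]) a            ∎
    where open ≡-Reasoning

  powers : ℤAction A
  powers = record
    { _·_     = λ a k → iterateℤ k a
    ; ·-zero  = λ _ → refl
    ; ·-assoc = iterateℤ-+
    }

-- Connected components of a diagram

module _ {A : Set} (X : Diagram A) where

  arcAction : ℤAction A
  arcAction = record { _·_ = _⊕_ X ; ·-zero = ⊕-zero X ; ·-assoc = ⊕-assoc X }

  Adjacent : Rel A 0ℓ
  Adjacent a b = _⁻¹ X a ≡ b ⊎ Shift arcAction a b

  SameComponent : Rel A 0ℓ
  SameComponent = EqClosure Adjacent

  Linked : Rel (V X) 0ℓ
  Linked x y = x ≡ y ⊎ Chain X x y

  s≡⇒sameComponent : ∀ {a b} → s X a ≡ s X b → SameComponent a b
  s≡⇒sameComponent {a} {b} e =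
    EqClosure.map inj₂ (Equivalence.to (ℤAction.sameOrbit⇔shifts arcAction) (Equivalence.to (orbit-star X a b) e))

  chain⇒sameComponent : ∀ {x y a b} → Chain X x y → s X a ≡ x → s X b ≡ y → SameComponent a b
  chain⇒sameComponent (single c sc≡x tc≡y) sa≡x sb≡y =
    s≡⇒sameComponent (trans sa≡x (sym sc≡x)) ◅◅
    (fwd (inj₁ refl) ◅ s≡⇒sameComponent (trans (s-⁻¹ X c) (trans tc≡y (sym sb≡y))))
  chain⇒sameComponent (_∷_ c sc≡x chain) sa≡x sb≡y =
    s≡⇒sameComponent (trans sa≡x (sym sc≡x)) ◅◅
    (fwd (inj₁ refl) ◅ chain⇒sameComponent chain (s-⁻¹ X c) sb≡y)

  adjacent-ends : ∀ {a b} → SymClosure Adjacent a b → s X a ≡ s X b ⊎ t X a ≡ s X b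
  adjacent-ends {a} (fwd (inj₁ refl))  = inj₂ (sym (s-⁻¹ X a))
  adjacent-ends {a} (fwd (inj₂ shift)) = inj₁ (Equivalence.from (orbit-star X a _) (1ℤ , shift))
  adjacent-ends {b = b} (bwd (inj₁ refl)) = inj₂ (t-⁻¹ X b)
  adjacent-ends {a} (bwd (inj₂ shift)) = inj₁ (sym (Equivalence.from (orbit-star X _ a) (1ℤ , shift)))

  sameComponent⇒linked : ∀ {a b} → SameComponent a b → Linked (s X a) (s X b)
  sameComponent⇒linked = Star.fold (λ a b → Linked (s X a) (s X b)) step (inj₁ refl)
    where
    step : ∀ {a b c} → SymClosure Adjacent a b → Linked (s X b) (s X c) → Linked (s X a) (s X c)
    step {a} {c = c} adj linked with adjacent-ends adj | linked
    ... | inj₁ sa≡sb | _              = subst (λ x → Linked x (s X c)) (sym sa≡sb) linked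
    ... | inj₂ ta≡sb | inj₁ sb≡sc    = inj₂ (single a refl (trans ta≡sb sb≡sc))
    ... | inj₂ ta≡sb | inj₂ chain    = inj₂ (_∷_ a refl (subst (λ x → Chain X x _) (sym ta≡sb) chain))

  oneComponent⇒connected : (∀ a b → SameComponent a b) → Connected X
  oneComponent⇒connected all x y x≢y with star-orbit X x | star-orbit X y
  ... | a , refl | b , refl with sameComponent⇒linked (all a b)
  ...   | inj₁ sa≡sb = contradiction sa≡sb x≢y
  ...   | inj₂ chain = chain

  -- Classically all arcs of a connected diagram lie in one component; constructively we
  -- only get this for ¬¬-stable relations containing SameComponent.
  connected⇒total : Connected X → {P : Rel A 0ℓ} → (∀ {a b} → SameComponent a b → P a b) →
                    (∀ {a b} → ¬ ¬ P a b → P a b) → ∀ a b → P a b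
  connected⇒total conn sameComponent⇒P stable a b = stable λ ¬Pab →
    ¬Pab (sameComponent⇒P (chain⇒sameComponent (conn _ _ (¬Pab ∘ sameComponent⇒P ∘ s≡⇒sameComponent)) refl refl))

  module _ {n : ℕ} (enum : A ↔ Fin n) where

    adjacent? : Decidable Adjacent
    adjacent? a b = (_⁻¹ X a ≟ b) ⊎-dec (_⊕_ X a 1ℤ ≟ b)
      where _≟_ = decEq enum

    sameComponent? : Decidable SameComponent
    sameComponent? = eqClosure? enum adjacent?

    components : Quotient SameComponent
    components = closureQuotient enum adjacent?

-- D* ≃ S₂ × S

enumeration : (E : FinSet) → ⌞ E ⌟ ↔ Fin (proj₁ (proj₂ E))
enumeration E = proj₂ (proj₂ E)

involution : {A : Set} → Diagram A → Invol A
involution X = record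
  { inv   = mk↔ₛ′ (_⁻¹ X) (_⁻¹ X) (⁻¹-invol X) (⁻¹-invol X)
  ; invol = ⁻¹-invol X
  }

rotation : {A : Set} → Diagram A → Perm A
rotation X = record
  { perm = mk↔ₛ′ (λ a → _⊕_ X a 1ℤ) (λ a → _⊕_ X a -1ℤ) (λ a → ·-cancel a -1ℤ) (λ a → ·-cancel a 1ℤ) }
  where open ℤAction (arcAction X)

module _ {A : Set} {n : ℕ} (enum : A ↔ Fin n) (ι : Invol A) (σ : Perm A) where
  private
    σ-powers = powers (Perm.perm σ)
    ι-to = Inverse.to (Invol.inv ι)

  cycles : Quotient (EqClosure (Shift σ-powers))
  cycles = closureQuotient enum (λ a b → decEq enum (Inverse.to (Perm.perm σ) a) b)

  open Quotient cycles

  diagramOf : Diagram A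
  diagramOf = record
    { V           = Fin size
    ; s           = cls
    ; t           = cls ∘ ι-to
    ; _⁻¹         = ι-to
    ; ⁻¹-invol    = Invol.invol ι
    ; s-⁻¹        = λ _ → refl
    ; t-⁻¹        = λ a → cong cls (Invol.invol ι a)
    ; _⊕_         = ℤAction._·_ σ-powers
    ; ⊕-zero      = ℤAction.·-zero σ-powers
    ; ⊕-assoc     = ℤAction.·-assoc σ-powers
    ; orbit-star  = λ a b → mk⇔ (Equivalence.from (ℤAction.sameOrbit⇔shifts σ-powers) ∘ cls-≡⇒∼)
                                (∼⇒cls-≡ ∘ Equivalence.to (ℤAction.sameOrbit⇔shifts σ-powers))
    ; star-orbit  = λ i → wit i , cls-wit i
    ; no-isolated = λ i → wit i , inj₁ (cls-wit i)
    }

module _ {A B : Set} {m n : ℕ} (enumA : A ↔ Fin m) (enumB : B ↔ Fin n) (α : A ↔ B)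
         {ι : Invol A} {σ : Perm A} {ι′ : Invol B} {σ′ : Perm B} where
  private
    α-to  = Inverse.to α
    ι-to  = Inverse.to (Invol.inv ι)
    ι′-to = Inverse.to (Invol.inv ι′)
    σ-to  = Inverse.to (Perm.perm σ)
    σ′-to = Inverse.to (Perm.perm σ′)

  diagramOf-natural : (∀ a → α-to (ι-to a) ≡ ι′-to (α-to a)) → (∀ a → α-to (σ-to a) ≡ σ′-to (α-to a)) →
                      DiagIso α-to (diagramOf enumA ι σ) (diagramOf enumB ι′ σ′)
  diagramOf-natural α-ι α-σ = record
    { vmap    = proj₁ ρ
    ; s-comm  = proj₂ ρ
    ; t-comm  = λ a → trans (proj₂ ρ (ι-to a)) (cong (Quotient.cls (cycles enumB ι′ σ′)) (α-ι a))
    ; ⁻¹-comm = α-ι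
    ; ⊕-comm  = equivariant (powers (Perm.perm σ)) (powers (Perm.perm σ′)) α-to α-σ
    }
    where
    ρ = quotient-transport α (cycles enumA ι σ) (cycles enumB ι′ σ′) (eqClosure-transport α (mk⇔
          (λ σa≡b → trans (sym (α-σ _)) (cong α-to σa≡b))
          (λ σ′αa≡αb → ↔-injective α (trans (α-σ _) σ′αa≡αb))))

diagramOf-involution-rotation : {A : Set} {n : ℕ} (enum : A ↔ Fin n) (X : Diagram A) →
                                DiagIso id (diagramOf enum (involution X) (rotation X)) X
diagramOf-involution-rotation enum X = record
  { vmap    = proj₁ ρ
  ; s-comm  = proj₂ ρ
  ; t-comm  = λ a → trans (proj₂ ρ (_⁻¹ X a)) (s-⁻¹ X a)
  ; ⁻¹-comm = λ _ → refl
  ; ⊕-comm  = equivariant (powers (Perm.perm (rotation X))) (arcAction X) id (λ _ → refl)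
  }
  where
  open ℤAction (arcAction X) using (sameOrbit⇔shifts)
  ρ = classes↔ (cycles enum (involution X) (rotation X)) (s X) (star-orbit X)
        (λ e → Equivalence.to sameOrbit⇔shifts (Equivalence.to (orbit-star X _ _) e))
        (λ r → Equivalence.from (orbit-star X _ _) (Equivalence.from sameOrbit⇔shifts r))

D*≅S₂×S : NatIso D* (S₂ ×ˢ S)
D*≅S₂×S = record
  { to       = λ _ X → involution X , rotation X
  ; from     = λ { E (ι , σ) → diagramOf (enumeration E) ι σ }
  ; to-nat   = λ _ _ _ d → lift (DiagIso.⁻¹-comm d) , lift (λ a → DiagIso.⊕-comm d a 1ℤ)
  ; from-nat = λ { E E′ α {ι , σ} {ι′ , σ′} (lift α-ι , lift α-σ) →
                   diagramOf-natural (enumeration E) (enumeration E′) α {ι} {σ} {ι′} {σ′} α-ι α-σ }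
  ; from-to  = λ E → diagramOf-involution-rotation (enumeration E)
  ; to-from  = λ _ _ → lift (λ _ → refl) , lift (λ _ → refl)
  }

-- Ens(D) ≃ D*

-- An arc a lies in its own block through refl; these lemmas move what is computed there
-- to the same arc seen in block i through any p : bl a ≡ i.
module _ {E : Set} {k : ℕ} {bl : E → Fin k} {B : Fin k → Set} (f : ∀ i → Block bl i → B i) where

  subst-own-block : ∀ {a i} (p : bl a ≡ i) → subst B p (f (bl a) (a , refl)) ≡ f i (a , p)
  subst-own-block refl = refl

  own-block : ∀ {a i} (p : bl a ≡ i) → _≡_ {A = Σ (Fin k) B} (bl a , f (bl a) (a , refl)) (i , f i (a , p))
  own-block refl = refl

arc-own-block : {E : Set} {k : ℕ} {bl : E → Fin k} (f : ∀ i → Block bl i → Block bl i) →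
                ∀ {a i} (p : bl a ≡ i) → proj₁ (f (bl a) (a , refl)) ≡ proj₁ (f i (a , p))
arc-own-block f p = cong (proj₁ ∘ proj₂) (own-block f p)

module Glue {E : Set} (X : EnsStr D E) where
  private
    bl = block X
    own : (a : E) → Block bl (bl a)
    own a = a , refl

  blockDiagram : (i : Fin (nblocks X)) → Diagram (Block bl i)
  blockDiagram i = proj₁ (struct X i)

  private
    sᵢ tᵢ : ∀ i → Block bl i → V (blockDiagram i)
    sᵢ i = s (blockDiagram i)
    tᵢ i = t (blockDiagram i)
    invᵢ : ∀ i → Block bl i → Block bl i
    invᵢ i = _⁻¹ (blockDiagram i)
    shiftᵢ : ℤ → ∀ i → Block bl i → Block bl i
    shiftᵢ k i u = _⊕_ (blockDiagram i) u k

  glue : Diagram E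
  glue .V               = Σ (Fin (nblocks X)) (V ∘ blockDiagram)
  glue .s a             = bl a , sᵢ (bl a) (own a)
  glue .t a             = bl a , tᵢ (bl a) (own a)
  glue ._⁻¹ a           = proj₁ (invᵢ (bl a) (own a))
  glue .⁻¹-invol a      = trans (arc-own-block invᵢ (proj₂ (invᵢ (bl a) (own a))))
                                (cong proj₁ (⁻¹-invol (blockDiagram (bl a)) (own a)))
  glue .s-⁻¹ a          = trans (own-block sᵢ (proj₂ (invᵢ (bl a) (own a))))
                                (cong (bl a ,_) (s-⁻¹ (blockDiagram (bl a)) (own a)))
  glue .t-⁻¹ a          = trans (own-block tᵢ (proj₂ (invᵢ (bl a) (own a))))
                                (cong (bl a ,_) (t-⁻¹ (blockDiagram (bl a)) (own a)))
  glue ._⊕_ a k         = proj₁ (shiftᵢ k (bl a) (own a))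
  glue .⊕-zero a        = cong proj₁ (⊕-zero (blockDiagram (bl a)) (own a))
  glue .⊕-assoc a k l   = trans (arc-own-block (shiftᵢ l) (proj₂ (shiftᵢ k (bl a) (own a))))
                                (cong proj₁ (⊕-assoc (blockDiagram (bl a)) (own a) k l))
  glue .orbit-star a b  = mk⇔ same-source⇒orbit orbit⇒same-source
    where
    same-source⇒orbit : glue .s a ≡ glue .s b → ∃ λ k → glue ._⊕_ a k ≡ b
    same-source⇒orbit e =
      let p             = ,-injectiveˡ e
          (k , shifted) = Equivalence.to (orbit-star (blockDiagram (bl b)) (a , p) (own b))
                            (,-injectiveʳ-UIP Fin-UIP (trans (sym (own-block sᵢ p)) e))
      in k , trans (arc-own-block (shiftᵢ k) p) (cong proj₁ shifted)
    orbit⇒same-source : (∃ λ k → glue ._⊕_ a k ≡ b) → glue .s a ≡ glue .s b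
    orbit⇒same-source (k , refl) =
      trans (cong (bl a ,_) (Equivalence.from (orbit-star (blockDiagram (bl a)) _ _) (k , refl)))
            (sym (own-block sᵢ (proj₂ (shiftᵢ k (bl a) (own a)))))
  glue .star-orbit (i , x) with star-orbit (blockDiagram i) x
  ... | (a , p) , refl = a , own-block sᵢ p
  glue .no-isolated x   = proj₁ (glue .star-orbit x) , inj₁ (proj₂ (glue .star-orbit x))

  sameComponent⇒sameBlock : ∀ {a b} → SameComponent glue a b → bl a ≡ bl b
  sameComponent⇒sameBlock = EqClosure.gfold isEquivalence bl adjacent⇒sameBlock
    where
    adjacent⇒sameBlock : ∀ {a b} → Adjacent glue a b → bl a ≡ bl b
    adjacent⇒sameBlock {a} (inj₁ refl) = sym (proj₂ (invᵢ (bl a) (own a)))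
    adjacent⇒sameBlock {a} (inj₂ refl) = sym (proj₂ (shiftᵢ 1ℤ (bl a) (own a)))

  blockComponent⇒sameComponent : ∀ {i u v} → SameComponent (blockDiagram i) u v →
                                 SameComponent glue (proj₁ u) (proj₁ v)
  blockComponent⇒sameComponent = EqClosure.gmap proj₁ blockAdjacent⇒adjacent
    where
    blockAdjacent⇒adjacent : ∀ {i u v} → Adjacent (blockDiagram i) u v → Adjacent glue (proj₁ u) (proj₁ v)
    blockAdjacent⇒adjacent {u = a , p} (inj₁ refl) = inj₁ (arc-own-block invᵢ p)
    blockAdjacent⇒adjacent {u = a , p} (inj₂ refl) = inj₂ (arc-own-block (shiftᵢ 1ℤ) p)

  sameBlock⇒sameComponent : ∀ {n} → E ↔ Fin n → ∀ {a b} → bl a ≡ bl b → SameComponent glue a b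
  sameBlock⇒sameComponent enum {a} {b} p =
    connected⇒total (blockDiagram (bl b)) (proj₂ (struct X (bl b)))
      {P = λ u v → SameComponent glue (proj₁ u) (proj₁ v)} blockComponent⇒sameComponent
      (decidable-stable (sameComponent? glue enum _ _)) (a , p) (b , refl)

open Glue using (glue; blockDiagram)

glue-natural : {E E′ : Set} {f : E → E′} {X : EnsStr D E} {Y : EnsStr D E′} →
               EnsIso D f X Y → DiagIso f (glue X) (glue Y)
glue-natural {f = f} {X} {Y} I = record
  { vmap    = Σ-↔ relabel (DiagIso.vmap (struct-iso _))
  ; s-comm  = λ a → trans (cong (ρ (block X a) ,_) (DiagIso.s-comm (struct-iso (block X a)) (a , refl)))
                          (sym (own-block (λ i → s (blockDiagram Y i)) (moved a)))
  ; t-comm  = λ a → trans (cong (ρ (block X a) ,_) (DiagIso.t-comm (struct-iso (block X a)) (a , refl)))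
                          (sym (own-block (λ i → t (blockDiagram Y i)) (moved a)))
  ; ⁻¹-comm = λ a → trans (cong proj₁ (DiagIso.⁻¹-comm (struct-iso (block X a)) (a , refl)))
                          (sym (arc-own-block (λ i → _⁻¹ (blockDiagram Y i)) (moved a)))
  ; ⊕-comm  = λ a k → trans (cong proj₁ (DiagIso.⊕-comm (struct-iso (block X a)) (a , refl) k))
                            (sym (arc-own-block (λ i u → _⊕_ (blockDiagram Y i) u k) (moved a)))
  }
  where
  open EnsIso I
  ρ = Inverse.to relabel
  moved : ∀ a → block Y (f a) ≡ ρ (block X a)
  moved a = proj₂ (blockMap f (block X) (block Y) relabel block-comm (block X a) (a , refl))

module Decompose {E : Set} {n : ℕ} (enum : E ↔ Fin n) (Y : Diagram E) where
  open Quotient (components Y enum) public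

  vertexComponent : V Y → Fin size
  vertexComponent x = cls (proj₁ (star-orbit Y x))

  vertexComponent-s : ∀ a → vertexComponent (s Y a) ≡ cls a
  vertexComponent-s a = ∼⇒cls-≡ (s≡⇒sameComponent Y (proj₂ (star-orbit Y (s Y a))))

  cls-⁻¹ : ∀ a → cls (_⁻¹ Y a) ≡ cls a
  cls-⁻¹ a = ∼⇒cls-≡ (EqClosure.symmetric (Adjacent Y) (EqClosure.return (inj₁ refl)))

  cls-⊕ : ∀ a k → cls (_⊕_ Y a k) ≡ cls a
  cls-⊕ a k = ∼⇒cls-≡ (EqClosure.symmetric (Adjacent Y) (EqClosure.map inj₂ (ℤAction.shifts-· (arcAction Y) a k)))

  vertexComponent-t : ∀ a → vertexComponent (t Y a) ≡ cls a
  vertexComponent-t a = trans (cong vertexComponent (sym (s-⁻¹ Y a))) (trans (vertexComponent-s _) (cls-⁻¹ a))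

  component : (i : Fin size) → Diagram (Block cls i)
  component i .V                     = Σ (V Y) (λ x → vertexComponent x ≡ i)
  component i .s (a , p)             = s Y a , trans (vertexComponent-s a) p
  component i .t (a , p)             = t Y a , trans (vertexComponent-t a) p
  component i ._⁻¹ (a , p)           = _⁻¹ Y a , trans (cls-⁻¹ a) p
  component i .⁻¹-invol (a , p)      = fibre-≡ (⁻¹-invol Y a)
  component i .s-⁻¹ (a , p)          = fibre-≡ (s-⁻¹ Y a)
  component i .t-⁻¹ (a , p)          = fibre-≡ (t-⁻¹ Y a)
  component i ._⊕_ (a , p) k         = _⊕_ Y a k , trans (cls-⊕ a k) p
  component i .⊕-zero (a , p)        = fibre-≡ (⊕-zero Y a)
  component i .⊕-assoc (a , p) k l   = fibre-≡ (⊕-assoc Y a k l)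
  component i .orbit-star (a , p) (b , q) = mk⇔
    (λ e → let (k , shifted) = Equivalence.to (orbit-star Y a b) (cong proj₁ e) in k , fibre-≡ shifted)
    (λ { (k , shifted) → fibre-≡ (Equivalence.from (orbit-star Y a b) (k , cong proj₁ shifted)) })
  component i .star-orbit (x , q)    = (proj₁ (star-orbit Y x) , q) , fibre-≡ (proj₂ (star-orbit Y x))
  component i .no-isolated x         = proj₁ (component i .star-orbit x) , inj₁ (proj₂ (component i .star-orbit x))

  restrictAdjacent : ∀ {i a b} {p : cls a ≡ i} {q : cls b ≡ i} →
                     SymClosure (Adjacent Y) a b → SymClosure (Adjacent (component i)) (a , p) (b , q)
  restrictAdjacent (fwd (inj₁ inverse)) = fwd (inj₁ (fibre-≡ inverse))
  restrictAdjacent (fwd (inj₂ shift))   = fwd (inj₂ (fibre-≡ shift))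
  restrictAdjacent (bwd (inj₁ inverse)) = bwd (inj₁ (fibre-≡ inverse))
  restrictAdjacent (bwd (inj₂ shift))   = bwd (inj₂ (fibre-≡ shift))

  restrict : ∀ {i a b} → SameComponent Y a b → (p : cls a ≡ i) (q : cls b ≡ i) →
             SameComponent (component i) (a , p) (b , q)
  restrict ε            p q = subst (SameComponent (component _) (_ , p)) (fibre-≡ refl) ε
  restrict (adj ◅ rest) p q = restrictAdjacent adj ◅ restrict rest (trans (sym (∼⇒cls-≡ (adj ◅ ε))) p) q

  component-connected : ∀ i → Connected (component i)
  component-connected i = oneComponent⇒connected (component i) λ (a , p) (b , q) →
    restrict (cls-≡⇒∼ (trans p (sym q))) p q

  decomposition : EnsStr D E
  decomposition .nblocks          = size
  decomposition .block            = cls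
  decomposition .block-nonempty i = wit i , cls-wit i
  decomposition .struct i         = component i , component-connected i

open Decompose using (decomposition)

glue-decomposition : {E : Set} {n : ℕ} (enum : E ↔ Fin n) (Y : Diagram E) →
                     DiagIso id (glue (decomposition enum Y)) Y
glue-decomposition enum Y = record
  { vmap    = Σ-fibres↔ (Decompose.vertexComponent enum Y)
  ; s-comm  = λ _ → refl
  ; t-comm  = λ _ → refl
  ; ⁻¹-comm = λ _ → refl
  ; ⊕-comm  = λ _ _ → refl
  }

module _ {A B : Set} {m n : ℕ} (enumA : A ↔ Fin m) (enumB : B ↔ Fin n) (α : A ↔ B)
         {X : Diagram A} {Y : Diagram B} (d : DiagIso (Inverse.to α) X Y) where
  open DiagIso d
  private
    module DX = Decompose enumA X
    module DY = Decompose enumB Y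
    α-to = Inverse.to α

    adjacent-transport : ∀ {a b} → Adjacent X a b ⇔ Adjacent Y (α-to a) (α-to b)
    adjacent-transport {a} = mk⇔
      (λ { (inj₁ inverse) → inj₁ (trans (sym (⁻¹-comm a)) (cong α-to inverse))
         ; (inj₂ shift)   → inj₂ (trans (sym (⊕-comm a 1ℤ)) (cong α-to shift)) })
      (λ { (inj₁ inverse) → inj₁ (↔-injective α (trans (⁻¹-comm a) inverse))
         ; (inj₂ shift)   → inj₂ (↔-injective α (trans (⊕-comm a 1ℤ) shift)) })

    ρ = quotient-transport α (components X enumA) (components Y enumB) (eqClosure-transport α adjacent-transport)

    vertexComponent-comm : ∀ x → DY.vertexComponent (Inverse.to vmap x) ≡ Inverse.to (proj₁ ρ) (DX.vertexComponent x)
    vertexComponent-comm x with star-orbit X x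
    ... | a , refl = trans (cong DY.vertexComponent (s-comm a)) (trans (DY.vertexComponent-s (α-to a)) (sym (proj₂ ρ a)))

  decomposition-natural : EnsIso D α-to DX.decomposition DY.decomposition
  decomposition-natural = record
    { relabel    = proj₁ ρ
    ; block-comm = λ a → sym (proj₂ ρ a)
    ; struct-iso = λ i → record
      { vmap    = Σ-↔ vmap (Fin-≡-↔ (mk⇔
                    (λ e → trans (vertexComponent-comm _) (cong (Inverse.to (proj₁ ρ)) e))
                    (λ e → ↔-injective (proj₁ ρ) (trans (sym (vertexComponent-comm _)) e))))
      ; s-comm  = λ u → fibre-≡ (s-comm (proj₁ u))
      ; t-comm  = λ u → fibre-≡ (t-comm (proj₁ u))
      ; ⁻¹-comm = λ u → fibre-≡ (⁻¹-comm (proj₁ u))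
      ; ⊕-comm  = λ u k → fibre-≡ (⊕-comm (proj₁ u) k)
      }
    }

module _ {E : Set} {n : ℕ} (enum : E ↔ Fin n) (X : EnsStr D E) where
  private
    open Decompose enum (glue X) using (vertexComponent)
    bl = block X
    sᵢ tᵢ : ∀ i → Block bl i → V (blockDiagram X i)
    sᵢ i = s (blockDiagram X i)
    tᵢ i = t (blockDiagram X i)

    ρ = classes↔ (components (glue X) enum) bl (block-nonempty X)
          (Glue.sameBlock⇒sameComponent X enum) (Glue.sameComponent⇒sameBlock X)
    ρ-to = Inverse.to (proj₁ ρ)

    vertexComponent-block : ∀ x → ρ-to (vertexComponent x) ≡ proj₁ x
    vertexComponent-block x with star-orbit (glue X) x
    ... | a , refl = proj₂ ρ a

    inBlock : ∀ {j} x → (vertexComponent x ≡ j) ⇔ (proj₁ x ≡ ρ-to j)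
    inBlock x = mk⇔ (λ e → trans (sym (vertexComponent-block x)) (cong ρ-to e))
                    (λ e → ↔-injective (proj₁ ρ) (trans (vertexComponent-block x) e))

  decomposition-glue : EnsIso D id (decomposition enum (glue X)) X
  decomposition-glue = record
    { relabel    = proj₁ ρ
    ; block-comm = λ a → sym (proj₂ ρ a)
    ; struct-iso = λ j → record
      { vmap    = Σ-singleton↔ ↔-∘ Σ-↔ ↔-refl (Fin-≡-↔ (inBlock _))
      ; s-comm  = λ { (a , _) → trans (subst-own-block sᵢ _) (cong (sᵢ _) (fibre-≡ refl)) }
      ; t-comm  = λ { (a , _) → trans (subst-own-block tᵢ _) (cong (tᵢ _) (fibre-≡ refl)) }
      ; ⁻¹-comm = λ { (a , _) → fibre-≡ (arc-own-block (λ i → _⁻¹ (blockDiagram X i)) _) }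
      ; ⊕-comm  = λ { (a , _) k → fibre-≡ (arc-own-block (λ i u → _⊕_ (blockDiagram X i) u k) _) }
      }
    }

-- The carrier ⌞ E ⌟ is passed explicitly: inferred from enumeration E it would be its
-- unfolding proj₁ E, and the mismatch sends conversion checking through the structures.
Ens-D≅D* : NatIso (Ens D) D*
Ens-D≅D* = record
  { to       = λ _ → glue
  ; from     = λ E → decomposition {⌞ E ⌟} (enumeration E)
  ; to-nat   = λ _ _ _ → glue-natural
  ; from-nat = λ E E′ α → decomposition-natural {⌞ E ⌟} {⌞ E′ ⌟} (enumeration E) (enumeration E′) α
  ; from-to  = λ E → decomposition-glue {⌞ E ⌟} (enumeration E)
  ; to-from  = λ E → glue-decomposition {⌞ E ⌟} (enumeration E)
  }

mainTheorem10 : NatIso (Ens D) D* × NatIso D* (S₂ ×ˢ S)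
mainTheorem10 = Ens-D≅D* , D*≅S₂×S
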